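{- Let $n\ge 2$ be even, let $t_1,\dots,t_n$ be teams with a distance matrix $D$ satisfying $D_{i,j}=D_{j,i}\ge 0$, $D_{i,i}=0$ and $D_{i,j}\le D_{i,h}+D_{h,j}$ for all $i,j,h$. Let $D_i=\sum_{j=1}^n D_{i,j}$, and let $D_M$ be the total weight of a minimum weight perfect matching $M$ in the complete graph $G$ on vertices $t_1,\dots,t_n$ where edge $t_at_b$ has weight $D_{a,b}$. Then the traveling distance of any itinerary of a team $t_i$ (in the sense of TTP-2) is at least $D_i+D_M$.
   Context: An itinerary of team $t_i$ in TTP-2 is a closed route that starts and ends at the home of $t_i$ and visits the home venue of every other team $t_j$ ($j\ne i$) exactly once (its away games), split into road trips: each road trip leaves the home of $t_i$, visits the homes of at most two other teams (since at most two consecutive away games are allowed), and returns to the home of $t_i$. Its traveling distance is the sum of $D$ over the consecutive legs of the route, where traveling from the home of $t_a$ to the home of $t_b$ costs $D_{a,b}$.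
   Formalization: The distance matrix D has rational entries. -}

module Defs where

open import Data.Nat using (ℕ)
open import Data.Fin using (Fin; _≟_)
open import Data.List using (List; []; _∷_; foldr; map; concatMap; filter; allFin)
open import Data.Product using (_×_; _,_)
open import Data.Rational using (ℚ; 0ℚ; _+_; _≤_)
open import Relation.Nullary using (¬_; ¬?)
open import Relation.Binary.PropositionalEquality using (_≡_)
open import Data.List.Relation.Binary.Permutation.Propositional using (_↭_)

sumℚ : List ℚ → ℚ
sumℚ = foldr _+_ 0ℚ

-- A distance matrix on n teams (team t_a is the index a : Fin n).
Dist : ℕ → Set
Dist n = Fin n → Fin n → ℚ

record IsMetric {n : ℕ} (D : Dist n) : Set where
  field
    symm    : ∀ i j → D i j ≡ D j i
    nonneg  : ∀ i j → 0ℚ ≤ D i j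
    diag    : ∀ i → D i i ≡ 0ℚ
    triangle : ∀ i j h → D i j ≤ D i h + D h j

rowSum : {n : ℕ} → Dist n → Fin n → ℚ
rowSum {n} D i = sumℚ (map (D i) (allFin n))

-- Perfect matchings of the complete graph on Fin n:
-- a list of edges {a,b} such that every vertex lies in exactly one edge.

Matching : ℕ → Set
Matching n = List (Fin n × Fin n)

endpoints : {n : ℕ} → Matching n → List (Fin n)
endpoints = concatMap (λ { (a , b) → a ∷ b ∷ [] })

IsPerfectMatching : {n : ℕ} → Matching n → Set
IsPerfectMatching {n} M = endpoints M ↭ allFin n

matchingWeight : {n : ℕ} → Dist n → Matching n → ℚ
matchingWeight D M = sumℚ (map (λ { (a , b) → D a b }) M)

IsMinPerfectMatching : {n : ℕ} → Dist n → Matching n → Set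
IsMinPerfectMatching {n} D M =
  IsPerfectMatching M × (∀ (M' : Matching n) → IsPerfectMatching M' → matchingWeight D M ≤ matchingWeight D M')

-- A road trip visits the homes of one or two other teams.
data RoadTrip (n : ℕ) : Set where
  one : Fin n → RoadTrip n
  two : Fin n → Fin n → RoadTrip n

visited : {n : ℕ} → RoadTrip n → List (Fin n)
visited (one a)   = a ∷ []
visited (two a b) = a ∷ b ∷ []

tripCost : {n : ℕ} → Dist n → Fin n → RoadTrip n → ℚ
tripCost D i (one a)   = D i a + D a i
tripCost D i (two a b) = D i a + D a b + D b i

others : {n : ℕ} → Fin n → List (Fin n)
others {n} i = filter (λ j → ¬? (j ≟ i)) (allFin n)

-- An itinerary of team i: a sequence of road trips that together visit
-- the home of every other team exactly once.
Itinerary : ℕ → Set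
Itinerary n = List (RoadTrip n)

IsItinerary : {n : ℕ} → Fin n → Itinerary n → Set
IsItinerary i T = concatMap visited T ↭ others i

travelDistance : {n : ℕ} → Dist n → Fin n → Itinerary n → ℚ
travelDistance D i T = sumℚ (map (tripCost D i) T)

-- Cut every road trip into edges: a trip through a and b contributes the edge ab,
-- and the teams visited on single-stop trips are paired up in order of their trips, the
-- first of them with t_i itself.  Since n is even this is a perfect matching.  A trip
-- i → a → b → i costs D_{i,a} + D_{i,b} + D_{a,b}, and of two single-stop trips to a and
-- a' the pair costs D_{i,a} + D_{i,a'} + D_{a,i} + D_{a',i} ≥ D_{i,a} + D_{i,a'} + D_{a,a'}
-- by the triangle inequality.  So the travel distance is at least D_i plus the weight of
-- that perfect matching, which is at least D_M.
module Submission where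

open import Defs
open import Data.Nat using (ℕ; _≥_; _*_)
open import Data.Fin using (Fin)
open import Data.Product using (∃)
open import Data.Rational using (_≤_; _+_)
open import Relation.Binary.PropositionalEquality using (_≡_)

open import Algebra.Bundles using (CommutativeMonoid)
open import Function using (id)
open import Data.Fin using (_≟_)
open import Data.List using ([]; _∷_; _++_; [_]; map; concatMap; filter; allFin; length; fromMaybe)
open import Data.List.Membership.Propositional using (_∈_)
open import Data.List.Membership.Propositional.Properties using (∈-allFin)
open import Data.List.Properties using (filter-accept; filter-reject; filter-all; length-++-comm; length-tabulate; ++-identityʳ)
open import Data.List.Relation.Binary.Permutation.Propositional using (_↭_; ↭-refl; prep; swap; ↭-sym; ↭-trans; ↭⇒↭ₛ)
open import Data.List.Relation.Binary.Permutation.Propositional.Properties using (shifts; map⁺; ↭-length)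
open import Data.List.Relation.Binary.Permutation.Setoid.Properties using (foldr-commMonoid)
open import Data.List.Relation.Unary.All as All using (lookup)
open import Data.List.Relation.Unary.AllPairs using (_∷_)
open import Data.List.Relation.Unary.Any using (here; there)
open import Data.List.Relation.Unary.Unique.Propositional using (Unique)
open import Data.List.Relation.Unary.Unique.Propositional.Properties using (allFin⁺)
open import Data.Maybe using (Maybe; just; nothing)
open import Data.Nat using (suc)
open import Data.Nat.Properties using (even≢odd; *-suc)
open import Data.Product using (_,_)
open import Data.Rational using (ℚ; 0ℚ)
open import Data.Rational.Properties using (+-0-commutativeMonoid; +-assoc; +-identityˡ; +-mono-≤; +-monoˡ-≤; +-monoʳ-≤; ≤-refl; ≤-reflexive; ≤-trans; module ≤-Reasoning)
open import Relation.Binary.Core using (_Preserves_⟶_)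
open import Relation.Binary.Definitions using (DecidableEquality)
open import Relation.Binary.PropositionalEquality using (refl; sym; trans; cong; cong₂; subst; ≢-sym; module ≡-Reasoning)
open import Relation.Nullary using (¬?; contradiction)

open import Algebra.Properties.CommutativeSemigroup (CommutativeMonoid.commutativeSemigroup +-0-commutativeMonoid)
  using (interchange; x∙yz≈y∙xz; xy∙z≈xz∙y)

sumℚ-↭ : sumℚ Preserves _↭_ ⟶ _≡_
sumℚ-↭ p = foldr-commMonoid ℚ-+-0.setoid ℚ-+-0.isCommutativeMonoid (↭⇒↭ₛ p)
  where module ℚ-+-0 = CommutativeMonoid +-0-commutativeMonoid

module _ {A : Set} (_≟ᴬ_ : DecidableEquality A) (x : A) where

  ∷-filter-≢-↭ : ∀ {xs} → Unique xs → x ∈ xs → x ∷ filter (λ y → ¬? (y ≟ᴬ x)) xs ↭ xs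
  ∷-filter-≢-↭ {y ∷ xs} (y∉xs ∷ _) (here refl)
    rewrite filter-reject (λ z → ¬? (z ≟ᴬ x)) {y} {xs} (λ x≢x → x≢x refl)
          | filter-all (λ z → ¬? (z ≟ᴬ x)) (All.map ≢-sym y∉xs) = ↭-refl
  ∷-filter-≢-↭ {y ∷ xs} (y∉xs ∷ unique) (there x∈xs)
    rewrite filter-accept (λ z → ¬? (z ≟ᴬ x)) {y} {xs} (lookup y∉xs x∈xs) =
      ↭-trans (swap x y ↭-refl) (prep y (∷-filter-≢-↭ unique x∈xs))

home∷visited↭allFin : ∀ {n} {i : Fin n} (T : Itinerary n) →
                      IsItinerary i T → i ∷ concatMap visited T ↭ allFin n
home∷visited↭allFin {n} {i} _ itinerary =
  ↭-trans (prep i itinerary) (∷-filter-≢-↭ _≟_ i (allFin⁺ n) (∈-allFin i))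

module _ {n : ℕ} where

  -- The Maybe argument is a team of a single-stop trip still waiting for a partner.
  tripMatching : Maybe (Fin n) → Itinerary n → Matching n
  tripMatching p        []              = []
  tripMatching p        (two a b ∷ T)   = (a , b) ∷ tripMatching p T
  tripMatching nothing  (one a ∷ T)     = tripMatching (just a) T
  tripMatching (just q) (one a ∷ T)     = (q , a) ∷ tripMatching nothing T

  unmatched : Maybe (Fin n) → Itinerary n → Maybe (Fin n)
  unmatched p        []            = p
  unmatched p        (two a b ∷ T) = unmatched p T
  unmatched nothing  (one a ∷ T)   = unmatched (just a) T
  unmatched (just q) (one a ∷ T)   = unmatched nothing T

  endpoints-tripMatching : ∀ p T →
    endpoints (tripMatching p T) ++ fromMaybe (unmatched p T) ↭ fromMaybe p ++ concatMap visited T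
  endpoints-tripMatching nothing  []            = ↭-refl
  endpoints-tripMatching (just q) []            = ↭-refl
  endpoints-tripMatching p        (two a b ∷ T) =
    ↭-trans (prep a (prep b (endpoints-tripMatching p T))) (↭-sym (shifts (fromMaybe p) (a ∷ b ∷ [])))
  endpoints-tripMatching nothing  (one a ∷ T)   = endpoints-tripMatching (just a) T
  endpoints-tripMatching (just q) (one a ∷ T)   = prep q (prep a (endpoints-tripMatching nothing T))

  length-endpoints : (M : Matching n) → length (endpoints M) ≡ 2 * length M
  length-endpoints []      = refl
  length-endpoints (_ ∷ M) = trans (cong (λ m → suc (suc m)) (length-endpoints M)) (sym (*-suc 2 (length M)))

  even⇒perfect : ∀ {k} → n ≡ 2 * k → (M : Matching n) (u : Maybe (Fin n)) →
                 endpoints M ++ fromMaybe u ↭ allFin n → IsPerfectMatching M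
  even⇒perfect _ M nothing cover = subst (_↭ allFin n) (++-identityʳ (endpoints M)) cover
  even⇒perfect {k} n≡2k M (just q) cover = contradiction 2k≡odd (even≢odd k (length M))
    where
    open ≡-Reasoning
    2k≡odd : 2 * k ≡ suc (2 * length M)
    2k≡odd = begin
      2 * k                           ≡⟨ sym n≡2k ⟩
      n                               ≡⟨ sym (length-tabulate id) ⟩
      length (allFin n)               ≡⟨ sym (↭-length cover) ⟩
      length (endpoints M ++ [ q ])   ≡⟨ length-++-comm (endpoints M) [ q ] ⟩
      suc (length (endpoints M))      ≡⟨ cong suc (length-endpoints M) ⟩
      suc (2 * length M)              ∎

visitedDistance : ∀ {n} → Dist n → Fin n → Itinerary n → ℚ
visitedDistance D i T = sumℚ (map (D i) (concatMap visited T))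

module _ {n : ℕ} {D : Dist n} (metric : IsMetric D) (i : Fin n) where
  open IsMetric metric
  open ≤-Reasoning

  rowSum≡visitedDistance : ∀ T → IsItinerary i T → rowSum D i ≡ visitedDistance D i T
  rowSum≡visitedDistance T itinerary = begin-equality
    sumℚ (map (D i) (allFin n))    ≡⟨ sumℚ-↭ (map⁺ (D i) (↭-sym (home∷visited↭allFin T itinerary))) ⟩
    D i i + visitedDistance D i T  ≡⟨ cong (_+ visitedDistance D i T) (diag i) ⟩
    0ℚ + visitedDistance D i T     ≡⟨ +-identityˡ _ ⟩
    visitedDistance D i T          ∎

  pendingReturn : Maybe (Fin n) → ℚ
  pendingReturn nothing  = 0ℚ
  pendingReturn (just q) = D q i

  detour : ∀ q a → D q a ≤ D q i + D a i
  detour q a = ≤-trans (triangle q a i) (≤-reflexive (cong (D q i +_) (symm i a)))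

  -- A pending team q has so far paid only D i q of its trip; the return leg D q i is
  -- still owed, and the detour through home pays for its future edge (q , a).
  visitedDistance+tripMatching≤travel : ∀ p T →
    visitedDistance D i T + matchingWeight D (tripMatching p T) ≤ pendingReturn p + travelDistance D i T
  visitedDistance+tripMatching≤travel nothing [] = ≤-refl
  visitedDistance+tripMatching≤travel (just q) [] = +-monoˡ-≤ 0ℚ (nonneg q i)
  visitedDistance+tripMatching≤travel p (two a b ∷ T) = begin
    (D i a + (D i b + S)) + (D a b + W)  ≡⟨ cong (_+ (D a b + W)) (+-assoc (D i a) (D i b) S) ⟨
    ((D i a + D i b) + S) + (D a b + W)  ≡⟨ interchange (D i a + D i b) S (D a b) W ⟩
    ((D i a + D i b) + D a b) + (S + W)  ≤⟨ +-mono-≤ (≤-reflexive tripCost-two)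
                                                        (visitedDistance+tripMatching≤travel p T) ⟩
    tripCost D i (two a b) + (pendingReturn p + R)  ≡⟨ x∙yz≈y∙xz (tripCost D i (two a b)) (pendingReturn p) R ⟩
    pendingReturn p + (tripCost D i (two a b) + R)  ∎
    where
    S = visitedDistance D i T
    W = matchingWeight D (tripMatching p T)
    R = travelDistance D i T
    tripCost-two : (D i a + D i b) + D a b ≡ tripCost D i (two a b)
    tripCost-two = trans (xy∙z≈xz∙y (D i a) (D i b) (D a b)) (cong (D i a + D a b +_) (symm i b))
  visitedDistance+tripMatching≤travel nothing (one a ∷ T) = begin
    (D i a + S) + W          ≡⟨ +-assoc (D i a) S W ⟩
    D i a + (S + W)          ≤⟨ +-monoʳ-≤ (D i a) (visitedDistance+tripMatching≤travel (just a) T) ⟩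
    D i a + (D a i + R)      ≡⟨ +-assoc (D i a) (D a i) R ⟨
    (D i a + D a i) + R      ≡⟨ +-identityˡ _ ⟨
    0ℚ + ((D i a + D a i) + R)  ∎
    where
    S = visitedDistance D i T
    W = matchingWeight D (tripMatching (just a) T)
    R = travelDistance D i T
  visitedDistance+tripMatching≤travel (just q) (one a ∷ T) = begin
    (D i a + S) + (D q a + W)               ≡⟨ interchange (D i a) S (D q a) W ⟩
    (D i a + D q a) + (S + W)               ≤⟨ +-mono-≤ (+-monoʳ-≤ (D i a) (detour q a))
                                                           (visitedDistance+tripMatching≤travel nothing T) ⟩
    (D i a + (D q i + D a i)) + (0ℚ + R)    ≡⟨ cong₂ _+_ (x∙yz≈y∙xz (D i a) (D q i) (D a i)) (+-identityˡ R) ⟩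
    (D q i + (D i a + D a i)) + R           ≡⟨ +-assoc (D q i) (D i a + D a i) R ⟩
    D q i + ((D i a + D a i) + R)           ∎
    where
    S = visitedDistance D i T
    W = matchingWeight D (tripMatching nothing T)
    R = travelDistance D i T

lemma2 : (n : ℕ) → n ≥ 2 → ∃ (λ k → n ≡ 2 * k) → (D : Dist n) → IsMetric D → (M : Matching n) → IsMinPerfectMatching D M → (i : Fin n) → (T : Itinerary n) → IsItinerary i T → rowSum D i + matchingWeight D M ≤ travelDistance D i T
lemma2 n _ (k , n≡2k) D metric M (_ , minimal) i T itinerary = begin
  rowSum D i + matchingWeight D M              ≤⟨ +-mono-≤ (≤-reflexive (rowSum≡visitedDistance metric i T itinerary))
                                                           (minimal M′ M′-perfect) ⟩
  visitedDistance D i T + matchingWeight D M′  ≤⟨ visitedDistance+tripMatching≤travel metric i (just i) T ⟩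
  D i i + travelDistance D i T                 ≡⟨ cong (_+ travelDistance D i T) (IsMetric.diag metric i) ⟩
  0ℚ + travelDistance D i T                    ≡⟨ +-identityˡ _ ⟩
  travelDistance D i T                         ∎
  where
  open ≤-Reasoning
  M′ = tripMatching (just i) T
  M′-perfect : IsPerfectMatching M′
  M′-perfect = even⇒perfect {k = k} n≡2k M′ (unmatched (just i) T)
    (↭-trans (endpoints-tripMatching (just i) T) (home∷visited↭allFin T itinerary))
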